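{- The multiplication of groves is associative: $(x\times y)\times z=x\times(y\times z)$ for all groves $x,y,z$; and the tree $1\in Y_1$ is a neutral element on both sides: $1\times y=y$ and $x\times 1=x$ for all groves $x,y$.
   Context: A planar binary tree of degree $n\ge 0$ is a planar rooted tree (up to planar isotopy) with $n+1$ leaves in which every internal vertex has exactly two inputs; $Y_n$ is the set of these trees, $Y_0=\{|\}$, and the unique tree of $Y_1$ is denoted $1$. For $x\in Y_p$, $y\in Y_q$ the grafting $x\vee y\in Y_{p+q+1}$ joins the roots of $x$ and $y$ to a new vertex with a new root; every $x\in Y_n$, $n\ge1$, decomposes uniquely as $x=x^l\vee x^r$. Tamari order on $Y_n$: the smallest partial order with $(a\vee b)\vee c\le a\vee(b\vee c)$, and $a\le b\Rightarrow a\vee c\le b\vee c,\ c\vee a\le c\vee b$. $x/y$ identifies the root of $x$ with the leftmost leaf of $y$; $x\backslash y$ identifies the rightmost leaf of $x$ with the root of $y$. Sum of trees: $x+y:=\{z\in Y_{p+q}: x/y\le z\le x\backslash y\}$. A grove is a nonempty subset of some $Y_n$; all operations on groves are extended from trees by distributivity (union over pairs), and grafting with a grove is elementwise. Left/Right sums of trees: $x\dashv y:=x^l\vee(x^r+y)$ for $x\ne|$, $x\vdash y:=(x+y^l)\vee y^r$ for $y\ne|$, $|\dashv y=|=y\vdash|$ for $y\ne|$, and by convention $|\dashv|=|\vdash|=|$. Product: for a tree $x$ and a grove $y$ define $W_|(y):=|$ and $W_x(y):=(W_{x^l}(y)\vdash y)\dashv W_{x^r}(y)$ for $x=x^l\vee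 x^r$; set $x\times y:=W_x(y)$, and for a grove $X$, $X\times y:=\bigcup_{x\in X}x\times y$. -}

module Defs where

open import Data.Nat using (ℕ; zero; suc; _+_)
open import Data.Product using (Σ; ∃; ∃-syntax; _×_; _,_)
open import Relation.Binary.PropositionalEquality using (_≡_)

-- Planar binary trees (up to planar isotopy = syntactic trees).
-- leaf = |, node x y = x ∨ y (grafting).
data Tree : Set where
  leaf : Tree
  node : Tree → Tree → Tree

-- degree = number of internal vertices (a tree of degree n has n+1 leaves)
deg : Tree → ℕ
deg leaf       = zero
deg (node l r) = suc (deg l + deg r)

one : Tree
one = node leaf leaf

data _≤T_ : Tree → Tree → Set where
  ≤T-refl  : ∀ {x} → x ≤T x
  ≤T-trans : ∀ {x y z} → x ≤T y → y ≤T z → x ≤T z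
  ≤T-rot   : ∀ {a b c} → node (node a b) c ≤T node a (node b c)
  ≤T-left  : ∀ {a b c} → a ≤T b → node a c ≤T node b c
  ≤T-right : ∀ {a b c} → a ≤T b → node c a ≤T node c b

-- x / y : root of x identified with the leftmost leaf of y
_/T_ : Tree → Tree → Tree
x /T leaf     = x
x /T node l r = node (x /T l) r

-- x \ y : rightmost leaf of x identified with the root of y
_∖T_ : Tree → Tree → Tree
leaf     ∖T y = y
node l r ∖T y = node l (r ∖T y)

Grove : Set₁
Grove = Tree → Set

IsGrove : Grove → Set
IsGrove X = (∃[ t ] X t) × (∀ s t → X s → X t → deg s ≡ deg t)

_≐_ : Grove → Grove → Set
X ≐ Y = ∀ t → (X t → Y t) × (Y t → X t)

SumT : Tree → Tree → Grove
SumT x y z = ((x /T y) ≤T z) × (z ≤T (x ∖T y))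

LSumT : Tree → Tree → Grove
LSumT leaf       y z = z ≡ leaf
LSumT (node l r) y z = ∃[ w ] SumT r y w × (z ≡ node l w)

RSumT : Tree → Tree → Grove
RSumT x leaf       z = z ≡ leaf
RSumT x (node l r) z = ∃[ w ] SumT x l w × (z ≡ node w r)

LSum : Grove → Grove → Grove
LSum X Y z = ∃[ x ] ∃[ y ] X x × Y y × LSumT x y z

RSum : Grove → Grove → Grove
RSum X Y z = ∃[ x ] ∃[ y ] X x × Y y × RSumT x y z

W : Tree → Grove → Grove
W leaf       Y z = z ≡ leaf
W (node l r) Y   = LSum (RSum (W l Y) Y) (W r Y)

_×G_ : Grove → Grove → Grove
(X ×G Y) z = ∃[ x ] X x × W x Y z

⟦_⟧ : Tree → Grove
⟦ t ⟧ z = z ≡ t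

-- The sum x + y = [x/y, x\y] has a combinatorial description: z ∈ x + y iff cutting z after
-- its first deg x internal vertices (in left-to-right order) leaves the trees x and y. The
-- cuts are monotone for the Tamari order, which is antisymmetric, and x/y, x\y both cut into
-- x and y; conversely every z lies in the sum of its two cuts. From this description the
-- sum of trees is associative, and for x, y ≠ | it is the union of x ⊣ y and x ⊢ y, so ⊣, ⊢
-- and + satisfy the dendriform relations on groves. For a grove Z, the map x ↦ W_x(Z) turns
-- the operations ⊣, ⊢, + on trees into the same operations on groves; induction on x then
-- gives W_x(Y) × Z = W_x(Y × Z), i.e. associativity. The unit laws come from | ⊢ y = y = y ⊣ |.
module Submission where

open import Defs
open import Data.Nat using (ℕ; suc; _+_; _∸_; _≤_; _<_; z≤n; s≤s; s≤s⁻¹)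
open import Data.Nat.Properties
open import Data.Nat.Tactic.RingSolver using (solve-∀)
open import Data.Product using (∃; ∃-syntax; _×_; _,_; proj₁; proj₂)
open import Data.Sum using (_⊎_; inj₁; inj₂)
open import Data.Empty using (⊥-elim)
open import Relation.Nullary using (yes; no; ¬_)
open import Relation.Binary.PropositionalEquality
open import Relation.Binary.Structures using (IsEquivalence)
open import Relation.Binary.Bundles using (Setoid)
import Level
import Relation.Binary.Reasoning.Setoid
open import Data.Bool using (Bool; true; false)

≤T-reflexive : ∀ {x y} → x ≡ y → x ≤T y
≤T-reflexive refl = ≤T-refl

infixr 5 _⟫_
_⟫_ : ∀ {x y z} → x ≤T y → y ≤T z → x ≤T z
_⟫_ = ≤T-trans

suc-+-assoc : ∀ a b c → suc (a + b) + c ≡ a + suc (b + c)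
suc-+-assoc a b c = trans (cong suc (+-assoc a b c)) (sym (+-suc a (b + c)))

≤T-deg : ∀ {x y} → x ≤T y → deg x ≡ deg y
≤T-deg ≤T-refl                = refl
≤T-deg (≤T-trans p q)         = trans (≤T-deg p) (≤T-deg q)
≤T-deg (≤T-rot {a} {b} {c})   = cong suc (suc-+-assoc (deg a) (deg b) (deg c))
≤T-deg (≤T-left {c = c} p)    = cong (λ k → suc (k + deg c)) (≤T-deg p)
≤T-deg (≤T-right {c = c} p)   = cong (λ k → suc (deg c + k)) (≤T-deg p)

-- Strictly increased by every rotation, which makes ≤T antisymmetric.
weight : Tree → ℕ
weight leaf       = 0
weight (node a b) = weight a + weight b + deg b

weight-rot : ∀ a b c → weight (node (node a b) c) < weight (node a (node b c))
weight-rot a b c =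
  subst (w <_) (rearrange (weight a) (weight b) (weight c) (deg b) (deg c)) (s≤s (m≤m+n w (deg c)))
  where
  w = weight (node (node a b) c)
  rearrange : ∀ wa wb wc db dc →
              suc (wa + wb + db + wc + dc + dc) ≡ wa + (wb + wc + dc) + suc (db + dc)
  rearrange = solve-∀

≤T-weight : ∀ {x y} → x ≤T y → x ≡ y ⊎ weight x < weight y
≤T-weight ≤T-refl = inj₁ refl
≤T-weight (≤T-trans p q) with ≤T-weight p | ≤T-weight q
... | inj₁ refl | r        = r
... | inj₂ l    | inj₁ refl = inj₂ l
... | inj₂ l    | inj₂ l′   = inj₂ (<-trans l l′)
≤T-weight (≤T-rot {a} {b} {c}) = inj₂ (weight-rot a b c)
≤T-weight (≤T-left {c = c} p) with ≤T-weight p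
... | inj₁ refl = inj₁ refl
... | inj₂ l    = inj₂ (+-monoˡ-< (deg c) (+-monoˡ-< (weight c) l))
≤T-weight (≤T-right {b = b} {c} p) with ≤T-weight p
... | inj₁ refl = inj₁ refl
... | inj₂ l rewrite ≤T-deg p = inj₂ (+-monoˡ-< (deg b) (+-monoʳ-< (weight c) l))

≤T-antisym : ∀ {x y} → x ≤T y → y ≤T x → x ≡ y
≤T-antisym p q with ≤T-weight p | ≤T-weight q
... | inj₁ e | _      = e
... | inj₂ _ | inj₁ e = sym e
... | inj₂ l | inj₂ l′ = ⊥-elim (<-asym l l′)

-- take p t and drop p t are the trees spanned by the first p and by the remaining
-- internal vertices of t, listed from left to right.
take : ℕ → Tree → Tree
take p leaf = leaf
take p (node a b) with p ≤? deg a
... | yes _ = take p a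
... | no _  = node a (take (p ∸ suc (deg a)) b)

drop : ℕ → Tree → Tree
drop p leaf = leaf
drop p (node a b) with p ≤? deg a
... | yes _ = node (drop p a) b
... | no _  = drop (p ∸ suc (deg a)) b

≤⊎beyond : ∀ p d → p ≤ d ⊎ ∃[ k ] p ≡ suc (d + k)
≤⊎beyond p d with p ≤? d
... | yes p≤d = inj₁ p≤d
... | no p≰d  = inj₂ (p ∸ suc d , sym (m+[n∸m]≡n (≰⇒> p≰d)))

beyond-≰ : ∀ d k → ¬ suc (d + k) ≤ d
beyond-≰ d k h = 1+n≰n (≤-trans (s≤s (m≤m+n d k)) h)

take-node-≤ : ∀ {p} a b → p ≤ deg a → take p (node a b) ≡ take p a
take-node-≤ {p} a b h with p ≤? deg a
... | yes _ = refl
... | no h′ = ⊥-elim (h′ h)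

take-node-beyond : ∀ k a b → take (suc (deg a + k)) (node a b) ≡ node a (take k b)
take-node-beyond k a b with suc (deg a + k) ≤? deg a
... | yes h = ⊥-elim (beyond-≰ _ _ h)
... | no _  = cong (λ m → node a (take m b)) (m+n∸m≡n (deg a) k)

drop-node-≤ : ∀ {p} a b → p ≤ deg a → drop p (node a b) ≡ node (drop p a) b
drop-node-≤ {p} a b h with p ≤? deg a
... | yes _ = refl
... | no h′ = ⊥-elim (h′ h)

drop-node-beyond : ∀ k a b → drop (suc (deg a + k)) (node a b) ≡ drop k b
drop-node-beyond k a b with suc (deg a + k) ≤? deg a
... | yes h = ⊥-elim (beyond-≰ _ _ h)
... | no _  = cong (λ m → drop m b) (m+n∸m≡n (deg a) k)

suc-+-cancelˡ-≤ : ∀ d {m n} → suc (d + m) ≤ suc (d + n) → m ≤ n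
suc-+-cancelˡ-≤ d h = +-cancelˡ-≤ d _ _ (s≤s⁻¹ h)

take-zero : ∀ t → take 0 t ≡ leaf
take-zero leaf       = refl
take-zero (node a b) = trans (take-node-≤ a b z≤n) (take-zero a)

drop-zero : ∀ t → drop 0 t ≡ t
drop-zero leaf       = refl
drop-zero (node a b) = trans (drop-node-≤ a b z≤n) (cong (λ u → node u b) (drop-zero a))

deg-drop : ∀ p t → p ≤ deg t → p + deg (drop p t) ≡ deg t
deg-drop p leaf z≤n = refl
deg-drop p (node a b) h with ≤⊎beyond p (deg a)
... | inj₁ h′ rewrite drop-node-≤ a b h′ = begin
  p + suc (deg (drop p a) + deg b)   ≡⟨ +-suc p _ ⟩
  suc (p + (deg (drop p a) + deg b)) ≡⟨ cong suc (+-assoc p _ _) ⟨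
  suc (p + deg (drop p a) + deg b)   ≡⟨ cong (λ m → suc (m + deg b)) (deg-drop p a h′) ⟩
  suc (deg a + deg b)                ∎
  where open ≡-Reasoning
... | inj₂ (k , refl) rewrite drop-node-beyond k a b =
  cong suc (trans (+-assoc (deg a) k _) (cong (deg a +_) (deg-drop k b (suc-+-cancelˡ-≤ (deg a) h))))

take-take : ∀ i j t → i ≤ j → take i (take j t) ≡ take i t
take-take i j leaf h = refl
take-take i j (node a b) h with ≤⊎beyond j (deg a)
... | inj₁ j≤a rewrite take-node-≤ a b j≤a | take-node-≤ a b (≤-trans h j≤a) = take-take i j a h
... | inj₂ (k , refl) rewrite take-node-beyond k a b with ≤⊎beyond i (deg a)
...   | inj₁ i≤a rewrite take-node-≤ a (take k b) i≤a | take-node-≤ a b i≤a = refl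
...   | inj₂ (m , refl) rewrite take-node-beyond m a (take k b) | take-node-beyond m a b =
  cong (node a) (take-take m k b (suc-+-cancelˡ-≤ (deg a) h))

drop-offset-≤ : ∀ {i} j a → j ≤ deg a → i ≤ deg (drop j a) → j + i ≤ deg a
drop-offset-≤ j a j≤a h = subst (_ ≤_) (deg-drop j a j≤a) (+-monoʳ-≤ j h)

drop-offset-beyond : ∀ j m a → j ≤ deg a → j + suc (deg (drop j a) + m) ≡ suc (deg a + m)
drop-offset-beyond j m a j≤a = begin
  j + suc (deg (drop j a) + m)   ≡⟨ +-suc j _ ⟩
  suc (j + (deg (drop j a) + m)) ≡⟨ cong suc (+-assoc j _ m) ⟨
  suc (j + deg (drop j a) + m)   ≡⟨ cong (λ n → suc (n + m)) (deg-drop j a j≤a) ⟩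
  suc (deg a + m)                ∎
  where open ≡-Reasoning

drop-drop : ∀ i j t → drop i (drop j t) ≡ drop (j + i) t
drop-drop i j leaf = refl
drop-drop i j (node a b) with ≤⊎beyond j (deg a)
... | inj₂ (k , refl)
  rewrite drop-node-beyond k a b | +-assoc (deg a) k i | drop-node-beyond (k + i) a b = drop-drop i k b
... | inj₁ j≤a rewrite drop-node-≤ a b j≤a with ≤⊎beyond i (deg (drop j a))
...   | inj₁ i≤ rewrite drop-node-≤ (drop j a) b i≤ | drop-node-≤ a b (drop-offset-≤ j a j≤a i≤) =
  cong (λ u → node u b) (drop-drop i j a)
...   | inj₂ (m , refl) rewrite drop-node-beyond m (drop j a) b | drop-offset-beyond j m a j≤a =
  sym (drop-node-beyond m a b)

take-drop : ∀ i j t → take i (drop j t) ≡ drop j (take (j + i) t)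
take-drop i j leaf = refl
take-drop i j (node a b) with ≤⊎beyond j (deg a)
... | inj₂ (k , refl)
  rewrite drop-node-beyond k a b | +-assoc (deg a) k i | take-node-beyond (k + i) a b
        | drop-node-beyond k a (take (k + i) b) = take-drop i k b
... | inj₁ j≤a rewrite drop-node-≤ a b j≤a with ≤⊎beyond i (deg (drop j a))
...   | inj₁ i≤ rewrite take-node-≤ (drop j a) b i≤ | take-node-≤ a b (drop-offset-≤ j a j≤a i≤) =
  take-drop i j a
...   | inj₂ (m , refl) rewrite take-node-beyond m (drop j a) b | drop-offset-beyond j m a j≤a
                              | take-node-beyond m a b = sym (drop-node-≤ a (take m b) j≤a)

left-≤-deg : ∀ {p} a b → p ≤ deg a → p ≤ deg (node a b)
left-≤-deg a b h = ≤-trans h (≤-trans (m≤m+n (deg a) (deg b)) (n≤1+n _))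

take-mono : ∀ p {x y} → x ≤T y → take p x ≤T take p y
take-mono p ≤T-refl         = ≤T-refl
take-mono p (≤T-trans h h′) = take-mono p h ⟫ take-mono p h′
take-mono p (≤T-rot {a} {b} {c}) with ≤⊎beyond p (deg a)
... | inj₁ h rewrite take-node-≤ (node a b) c (left-≤-deg a b h) | take-node-≤ a b h
                   | take-node-≤ a (node b c) h = ≤T-refl
... | inj₂ (k , refl) with ≤⊎beyond k (deg b)
...   | inj₁ h rewrite take-node-≤ (node a b) c (s≤s (+-monoʳ-≤ (deg a) h)) | take-node-beyond k a b
                     | take-node-beyond k a (node b c) | take-node-≤ b c h = ≤T-refl
...   | inj₂ (m , refl) rewrite take-node-beyond (suc (deg b + m)) a (node b c) | take-node-beyond m b c
                              | sym (suc-+-assoc (deg a) (deg b) m) | take-node-beyond m (node a b) c = ≤T-rot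
take-mono p (≤T-left {a} {b} {c} h) with ≤⊎beyond p (deg a)
... | inj₁ h′ rewrite take-node-≤ a c h′ | take-node-≤ b c (subst (p ≤_) (≤T-deg h) h′) =
  take-mono p h
... | inj₂ (k , refl) rewrite take-node-beyond k a c | ≤T-deg h | take-node-beyond k b c = ≤T-left h
take-mono p (≤T-right {a} {b} {c} h) with ≤⊎beyond p (deg c)
... | inj₁ h′ rewrite take-node-≤ c a h′ | take-node-≤ c b h′ = ≤T-refl
... | inj₂ (k , refl) rewrite take-node-beyond k c a | take-node-beyond k c b = ≤T-right (take-mono k h)

drop-mono : ∀ p {x y} → x ≤T y → drop p x ≤T drop p y
drop-mono p ≤T-refl         = ≤T-refl
drop-mono p (≤T-trans h h′) = drop-mono p h ⟫ drop-mono p h′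
drop-mono p (≤T-rot {a} {b} {c}) with ≤⊎beyond p (deg a)
... | inj₁ h rewrite drop-node-≤ (node a b) c (left-≤-deg a b h) | drop-node-≤ a b h
                   | drop-node-≤ a (node b c) h = ≤T-rot
... | inj₂ (k , refl) with ≤⊎beyond k (deg b)
...   | inj₁ h rewrite drop-node-≤ (node a b) c (s≤s (+-monoʳ-≤ (deg a) h)) | drop-node-beyond k a b
                     | drop-node-beyond k a (node b c) | drop-node-≤ b c h = ≤T-refl
...   | inj₂ (m , refl) rewrite drop-node-beyond (suc (deg b + m)) a (node b c) | drop-node-beyond m b c
                              | sym (suc-+-assoc (deg a) (deg b) m) | drop-node-beyond m (node a b) c = ≤T-refl
drop-mono p (≤T-left {a} {b} {c} h) with ≤⊎beyond p (deg a)
... | inj₁ h′ rewrite drop-node-≤ a c h′ | drop-node-≤ b c (subst (p ≤_) (≤T-deg h) h′) =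
  ≤T-left (drop-mono p h)
... | inj₂ (k , refl) rewrite drop-node-beyond k a c | ≤T-deg h | drop-node-beyond k b c = ≤T-refl
drop-mono p (≤T-right {a} {b} {c} h) with ≤⊎beyond p (deg c)
... | inj₁ h′ rewrite drop-node-≤ c a h′ | drop-node-≤ c b h′ = ≤T-right h
... | inj₂ (k , refl) rewrite drop-node-beyond k c a | drop-node-beyond k c b = drop-mono k h

take-deg : ∀ t → take (deg t) t ≡ t
take-deg leaf       = refl
take-deg (node a b) = trans (take-node-beyond (deg b) a b) (cong (node a) (take-deg b))

drop-deg : ∀ t → drop (deg t) t ≡ leaf
drop-deg leaf       = refl
drop-deg (node a b) = trans (drop-node-beyond (deg b) a b) (drop-deg b)

leaf-/T : ∀ y → leaf /T y ≡ y
leaf-/T leaf       = refl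
leaf-/T (node l r) = cong (λ u → node u r) (leaf-/T l)

∖T-leaf : ∀ x → x ∖T leaf ≡ x
∖T-leaf leaf       = refl
∖T-leaf (node l r) = cong (node l) (∖T-leaf r)

deg-/T : ∀ x y → deg (x /T y) ≡ deg x + deg y
deg-/T x leaf       = sym (+-identityʳ (deg x))
deg-/T x (node l r) = begin
  suc (deg (x /T l) + deg r)    ≡⟨ cong (λ n → suc (n + deg r)) (deg-/T x l) ⟩
  suc (deg x + deg l + deg r)   ≡⟨ cong suc (+-assoc (deg x) (deg l) (deg r)) ⟩
  suc (deg x + (deg l + deg r)) ≡⟨ +-suc (deg x) _ ⟨
  deg x + suc (deg l + deg r)   ∎
  where open ≡-Reasoning

deg-≤-deg-/T : ∀ x y → deg x ≤ deg (x /T y)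
deg-≤-deg-/T x y = subst (deg x ≤_) (sym (deg-/T x y)) (m≤m+n _ _)

take-/T : ∀ x y → take (deg x) (x /T y) ≡ x
take-/T x leaf       = take-deg x
take-/T x (node l r) = trans (take-node-≤ (x /T l) r (deg-≤-deg-/T x l)) (take-/T x l)

drop-/T : ∀ x y → drop (deg x) (x /T y) ≡ y
drop-/T x leaf       = drop-deg x
drop-/T x (node l r) =
  trans (drop-node-≤ (x /T l) r (deg-≤-deg-/T x l)) (cong (λ u → node u r) (drop-/T x l))

take-∖T : ∀ x y → take (deg x) (x ∖T y) ≡ x
take-∖T leaf       y = take-zero y
take-∖T (node a b) y = trans (take-node-beyond (deg b) a (b ∖T y)) (cong (node a) (take-∖T b y))

drop-∖T : ∀ x y → drop (deg x) (x ∖T y) ≡ y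
drop-∖T leaf       y = drop-zero y
drop-∖T (node a b) y = trans (drop-node-beyond (deg b) a (b ∖T y)) (drop-∖T b y)

node-/T-≤T : ∀ a b y → (node a b /T y) ≤T node a (b /T y)
node-/T-≤T a b leaf       = ≤T-refl
node-/T-≤T a b (node l r) = ≤T-left (node-/T-≤T a b l) ⟫ ≤T-rot

∖T-node-≤T : ∀ x l r → node (x ∖T l) r ≤T (x ∖T node l r)
∖T-node-≤T leaf       l r = ≤T-refl
∖T-node-≤T (node a b) l r = ≤T-rot ⟫ ≤T-right (∖T-node-≤T b l r)

/T-≤T-∖T : ∀ x y → (x /T y) ≤T (x ∖T y)
/T-≤T-∖T x leaf       = ≤T-reflexive (sym (∖T-leaf x))
/T-≤T-∖T x (node l r) = ≤T-left (/T-≤T-∖T x l) ⟫ ∖T-node-≤T x l r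

SumT-/T : ∀ x y → SumT x y (x /T y)
SumT-/T x y = ≤T-refl , /T-≤T-∖T x y

SumT-deg : ∀ {x y z} → SumT x y z → deg z ≡ deg x + deg y
SumT-deg {x} {y} (lo , _) = trans (sym (≤T-deg lo)) (deg-/T x y)

SumT-take-drop : ∀ p z → SumT (take p z) (drop p z) z
SumT-take-drop p leaf = ≤T-refl , ≤T-refl
SumT-take-drop p (node a b) with ≤⊎beyond p (deg a)
... | inj₁ h rewrite take-node-≤ a b h | drop-node-≤ a b h =
  let (lo , hi) = SumT-take-drop p a in
  ≤T-left lo , ≤T-left hi ⟫ ∖T-node-≤T (take p a) (drop p a) b
... | inj₂ (k , refl) rewrite take-node-beyond k a b | drop-node-beyond k a b =
  let (lo , hi) = SumT-take-drop k b in
  node-/T-≤T a (take k b) (drop k b) ⟫ ≤T-right lo , ≤T-right hi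

SumT⇒take : ∀ {x y z} → SumT x y z → take (deg x) z ≡ x
SumT⇒take {x} {y} (lo , hi) =
  sym (≤T-antisym (≤T-reflexive (sym (take-/T x y)) ⟫ take-mono (deg x) lo)
                  (take-mono (deg x) hi ⟫ ≤T-reflexive (take-∖T x y)))

SumT⇒drop : ∀ {x y z} → SumT x y z → drop (deg x) z ≡ y
SumT⇒drop {x} {y} (lo , hi) =
  sym (≤T-antisym (≤T-reflexive (sym (drop-/T x y)) ⟫ drop-mono (deg x) lo)
                  (drop-mono (deg x) hi ⟫ ≤T-reflexive (drop-∖T x y)))

split⇒SumT : ∀ {x y z} → take (deg x) z ≡ x → drop (deg x) z ≡ y → SumT x y z
split⇒SumT {x} {z = z} t d = subst₂ (λ u v → SumT u v z) t d (SumT-take-drop (deg x) z)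

SumT-leafˡ : ∀ y → SumT leaf y y
SumT-leafˡ y = ≤T-reflexive (leaf-/T y) , ≤T-refl

SumT-leafˡ-unique : ∀ {y z} → SumT leaf y z → z ≡ y
SumT-leafˡ-unique {y} (lo , hi) = ≤T-antisym hi (≤T-reflexive (sym (leaf-/T y)) ⟫ lo)

SumT-leafʳ : ∀ x → SumT x leaf x
SumT-leafʳ x = ≤T-refl , ≤T-reflexive (sym (∖T-leaf x))

SumT-leafʳ-unique : ∀ {x z} → SumT x leaf z → z ≡ x
SumT-leafʳ-unique {x} (lo , hi) = ≤T-antisym (hi ⟫ ≤T-reflexive (∖T-leaf x)) lo

LSumT⊆SumT : ∀ {a b y z} → LSumT (node a b) y z → SumT (node a b) y z
LSumT⊆SumT {a} {b} {y} (w , (lo , hi) , refl) = node-/T-≤T a b y ⟫ ≤T-right lo , ≤T-right hi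

RSumT⊆SumT : ∀ {x c d z} → RSumT x (node c d) z → SumT x (node c d) z
RSumT⊆SumT {x} {c} {d} (w , (lo , hi) , refl) = ≤T-left lo , ≤T-left hi ⟫ ∖T-node-≤T x c d

SumT⊆LSumT⊎RSumT : ∀ {a b c d z} → SumT (node a b) (node c d) z →
                   LSumT (node a b) (node c d) z ⊎ RSumT (node a b) (node c d) z
SumT⊆LSumT⊎RSumT {a} {b} {c} {d} {z} s = by-split z _ refl (SumT⇒take s) (SumT⇒drop s)
  where
  -- n stands for deg (node a b), kept as a variable so that the case split on n can refine it.
  by-split : ∀ z n → n ≡ deg (node a b) → take n z ≡ node a b → drop n z ≡ node c d →
             LSumT (node a b) (node c d) z ⊎ RSumT (node a b) (node c d) z
  by-split leaf n _ () _
  by-split (node p q) n n≡ t dr with ≤⊎beyond n (deg p)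
  ... | inj₁ h rewrite take-node-≤ p q h | drop-node-≤ p q h with n≡ | dr
  ...   | refl | refl = inj₂ (p , split⇒SumT t refl , refl)
  by-split (node p q) _ n≡ t dr | inj₂ (k , refl)
    rewrite take-node-beyond k p q | drop-node-beyond k p q with t
  ...   | refl = inj₁ (q , split⇒SumT (subst (λ m → take m q ≡ take k q) k≡ refl)
                                     (subst (λ m → drop m q ≡ node c d) k≡ dr) , refl)
    where
    k≡ : k ≡ deg (take k q)
    k≡ = +-cancelˡ-≡ (deg p) _ _ (suc-injective n≡)

SumT-assocʳ : ∀ {x y r w t} → SumT x y w → SumT w r t → ∃[ v ] SumT y r v × SumT x v t
SumT-assocʳ {x} {y} {r} {w} {t} xy wr =
  drop (deg x) t , split⇒SumT take-y drop-r , split⇒SumT take-x refl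
  where
  open ≡-Reasoning
  deg-w : deg w ≡ deg x + deg y
  deg-w = SumT-deg {x} {y} xy
  x≤w : deg x ≤ deg w
  x≤w = subst (deg x ≤_) (sym deg-w) (m≤m+n _ _)
  take-x : take (deg x) t ≡ x
  take-x = begin
    take (deg x) t                ≡⟨ take-take (deg x) (deg w) t x≤w ⟨
    take (deg x) (take (deg w) t) ≡⟨ cong (take (deg x)) (SumT⇒take wr) ⟩
    take (deg x) w                ≡⟨ SumT⇒take xy ⟩
    x                             ∎
  take-y : take (deg y) (drop (deg x) t) ≡ y
  take-y = begin
    take (deg y) (drop (deg x) t)         ≡⟨ take-drop (deg y) (deg x) t ⟩
    drop (deg x) (take (deg x + deg y) t) ≡⟨ cong (λ n → drop (deg x) (take n t)) deg-w ⟨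
    drop (deg x) (take (deg w) t)         ≡⟨ cong (drop (deg x)) (SumT⇒take wr) ⟩
    drop (deg x) w                        ≡⟨ SumT⇒drop xy ⟩
    y                                     ∎
  drop-r : drop (deg y) (drop (deg x) t) ≡ r
  drop-r = begin
    drop (deg y) (drop (deg x) t) ≡⟨ drop-drop (deg y) (deg x) t ⟩
    drop (deg x + deg y) t        ≡⟨ cong (λ n → drop n t) deg-w ⟨
    drop (deg w) t                ≡⟨ SumT⇒drop wr ⟩
    r                             ∎

SumT-assocˡ : ∀ {x y r v t} → SumT y r v → SumT x v t → ∃[ w ] SumT x y w × SumT w r t
SumT-assocˡ {x} {y} {r} {v} {t} yr xv = w , xy , split⇒SumT take-w drop-r
  where
  open ≡-Reasoning
  w = take (deg x + deg y) t
  take-x : take (deg x) w ≡ x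
  take-x = trans (take-take (deg x) (deg x + deg y) t (m≤m+n _ _)) (SumT⇒take xv)
  drop-y : drop (deg x) w ≡ y
  drop-y = begin
    drop (deg x) w                ≡⟨ take-drop (deg y) (deg x) t ⟨
    take (deg y) (drop (deg x) t) ≡⟨ cong (take (deg y)) (SumT⇒drop xv) ⟩
    take (deg y) v                ≡⟨ SumT⇒take yr ⟩
    y                             ∎
  xy : SumT x y w
  xy = split⇒SumT take-x drop-y
  take-w : take (deg w) t ≡ w
  take-w = cong (λ n → take n t) (SumT-deg {x} {y} xy)
  drop-r : drop (deg w) t ≡ r
  drop-r = begin
    drop (deg w) t                ≡⟨ cong (λ n → drop n t) (SumT-deg {x} {y} xy) ⟩
    drop (deg x + deg y) t        ≡⟨ drop-drop (deg y) (deg x) t ⟨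
    drop (deg y) (drop (deg x) t) ≡⟨ cong (drop (deg y)) (SumT⇒drop xv) ⟩
    drop (deg y) v                ≡⟨ SumT⇒drop yr ⟩
    r                             ∎

-- Lift F extends a tree operation to groves by distributivity and Bind X g is ⋃_{x ∈ X} g x;
-- thus LSum, RSum and X ×G Y are Lift LSumT, Lift RSumT and Bind X (λ x → W x Y) by definition.
TreeOp : Set₁
TreeOp = Tree → Tree → Grove

Lift : TreeOp → Grove → Grove → Grove
Lift F X Y t = ∃[ x ] ∃[ y ] X x × Y y × F x y t

Bind : Grove → (Tree → Grove) → Grove
Bind X g t = ∃[ x ] X x × g x t

≐-isEquivalence : IsEquivalence _≐_
≐-isEquivalence = record
  { refl  = λ t → (λ z → z) , (λ z → z)
  ; sym   = λ e t → proj₂ (e t) , proj₁ (e t)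
  ; trans = λ e f t → (λ z → proj₁ (f t) (proj₁ (e t) z)) , (λ z → proj₂ (e t) (proj₂ (f t) z))
  }

≐-setoid : Setoid (Level.suc Level.zero) Level.zero
≐-setoid = record { isEquivalence = ≐-isEquivalence }

open IsEquivalence ≐-isEquivalence using () renaming (refl to ≐-refl)

Lift-cong : ∀ F {X X′ Y Y′} → X ≐ X′ → Y ≐ Y′ → Lift F X Y ≐ Lift F X′ Y′
Lift-cong F e f t = (λ (x , y , Xx , Yy , Fxy) → x , y , proj₁ (e x) Xx , proj₁ (f y) Yy , Fxy)
                  , (λ (x , y , Xx , Yy , Fxy) → x , y , proj₂ (e x) Xx , proj₂ (f y) Yy , Fxy)

Lift-assoc : ∀ F₁ F₂ G₁ G₂ →
  (∀ {p q r s t} → F₁ p q s → F₂ s r t → ∃[ u ] G₁ q r u × G₂ p u t) →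
  (∀ {p q r u t} → G₁ q r u → G₂ p u t → ∃[ s ] F₁ p q s × F₂ s r t) →
  ∀ P Q R → Lift F₂ (Lift F₁ P Q) R ≐ Lift G₂ P (Lift G₁ Q R)
Lift-assoc F₁ F₂ G₁ G₂ to from P Q R t =
  (λ (s , r , (p , q , Pp , Qq , f₁) , Rr , f₂) → let (u , g₁ , g₂) = to f₁ f₂ in
     p , u , Pp , (q , r , Qq , Rr , g₁) , g₂) ,
  (λ (p , u , Pp , (q , r , Qq , Rr , g₁) , g₂) → let (s , f₁ , f₂) = from g₁ g₂ in
     s , r , (p , q , Pp , Qq , f₁) , Rr , f₂)

Bind-Lift : ∀ F G (g : Tree → Grove) → (∀ a c → Bind (F a c) g ≐ Lift G (g a) (g c)) →
            ∀ A C → Bind (Lift F A C) g ≐ Lift G (Bind A g) (Bind C g)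
Bind-Lift F G g hom A C t =
  (λ (s , (a , c , Aa , Cc , Fs) , gs) →
     let (x , y , gx , gy , Gt) = proj₁ (hom a c t) (s , Fs , gs) in
     x , y , (a , Aa , gx) , (c , Cc , gy) , Gt) ,
  (λ (x , y , (a , Aa , gx) , (c , Cc , gy) , Gt) →
     let (s , Fs , gs) = proj₂ (hom a c t) (x , y , gx , gy , Gt) in
     s , (a , c , Aa , Cc , Fs) , gs)

Bind-Liftˡ : ∀ F Q S (g : Tree → Grove) → Bind S (λ w → Lift F (g w) Q) ≐ Lift F (Bind S g) Q
Bind-Liftˡ F Q S g t = (λ (w , Sw , x , q , gx , Qq , Ft) → x , q , (w , Sw , gx) , Qq , Ft)
                     , (λ (x , q , (w , Sw , gx) , Qq , Ft) → w , Sw , x , q , gx , Qq , Ft)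

Bind-Liftʳ : ∀ F P S (g : Tree → Grove) → Bind S (λ w → Lift F P (g w)) ≐ Lift F P (Bind S g)
Bind-Liftʳ F P S g t = (λ (w , Sw , p , y , Pp , gy , Ft) → p , y , Pp , (w , Sw , gy) , Ft)
                     , (λ (p , y , Pp , (w , Sw , gy) , Ft) → w , Sw , p , y , Pp , gy , Ft)

Bind-image : ∀ (S : Grove) (m : Tree → Tree) (g : Tree → Grove) →
             Bind (λ s → ∃[ w ] S w × s ≡ m w) g ≐ Bind S (λ w → g (m w))
Bind-image S m g t = (λ { (s , (w , Sw , refl) , gs) → w , Sw , gs })
                   , (λ (w , Sw , gs) → m w , (w , Sw , refl) , gs)

LSum-LSum : ∀ P Q R → Lift LSumT (Lift LSumT P Q) R ≐ Lift LSumT P (Lift SumT Q R)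
LSum-LSum = Lift-assoc LSumT LSumT SumT LSumT to from
  where
  to : ∀ {p q r s t} → LSumT p q s → LSumT s r t → ∃[ u ] SumT q r u × LSumT p u t
  to {leaf} {q} {r} refl refl = q /T r , SumT-/T q r , refl
  to {node _ _} (w , qw , refl) (v , wv , refl) =
    let (u , ru , qu) = SumT-assocʳ qw wv in u , ru , v , qu , refl
  from : ∀ {p q r u t} → SumT q r u → LSumT p u t → ∃[ s ] LSumT p q s × LSumT s r t
  from {leaf} _ refl = leaf , refl , refl
  from {node p₁ _} qr (v , uv , refl) =
    let (w , qw , wv) = SumT-assocˡ qr uv in node p₁ w , (w , qw , refl) , (v , wv , refl)

Sum-RSum : ∀ P Q R → Lift RSumT (Lift SumT P Q) R ≐ Lift RSumT P (Lift RSumT Q R)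
Sum-RSum = Lift-assoc SumT RSumT RSumT RSumT to from
  where
  to : ∀ {p q r s t} → SumT p q s → RSumT s r t → ∃[ u ] RSumT q r u × RSumT p u t
  to {r = leaf} _ refl = leaf , refl , refl
  to {r = node _ r₂} pq (w , sw , refl) =
    let (v , qv , pv) = SumT-assocʳ pq sw in node v r₂ , (v , qv , refl) , (w , pv , refl)
  from : ∀ {p q r u t} → RSumT q r u → RSumT p u t → ∃[ s ] SumT p q s × RSumT s r t
  from {p} {q} {leaf} refl refl = p /T q , SumT-/T p q , refl
  from {r = node _ _} (v , qv , refl) (w , pv , refl) =
    let (s , pq , sw) = SumT-assocˡ qv pv in s , pq , (w , sw , refl)

RSum-LSum : ∀ P Q R → Lift LSumT (Lift RSumT P Q) R ≐ Lift RSumT P (Lift LSumT Q R)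
RSum-LSum = Lift-assoc RSumT LSumT LSumT RSumT to from
  where
  to : ∀ {p q r s t} → RSumT p q s → LSumT s r t → ∃[ u ] LSumT q r u × RSumT p u t
  to {q = leaf} refl refl = leaf , refl , refl
  to {q = node q₁ _} (w , pw , refl) (v , qv , refl) = node q₁ v , (v , qv , refl) , (w , pw , refl)
  from : ∀ {p q r u t} → LSumT q r u → RSumT p u t → ∃[ s ] RSumT p q s × LSumT s r t
  from {q = leaf} refl refl = leaf , refl , refl
  from {q = node _ q₂} (v , qv , refl) (w , pw , refl) = node w q₂ , (w , pw , refl) , (v , qv , refl)

LSumT-nonempty : ∀ x y → ∃ (LSumT x y)
LSumT-nonempty leaf       y = leaf , refl
LSumT-nonempty (node a b) y = node a (b /T y) , b /T y , SumT-/T b y , refl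

RSumT-nonempty : ∀ x y → ∃ (RSumT x y)
RSumT-nonempty x leaf       = leaf , refl
RSumT-nonempty x (node l r) = node (x /T l) r , x /T l , SumT-/T x l , refl

W-nonempty : ∀ {Z} → ∃ Z → ∀ x → ∃ (W x Z)
W-nonempty Z≠∅ leaf = leaf , refl
W-nonempty Z≠∅@(z , Zz) (node l r) =
  let (u , Wu) = W-nonempty Z≠∅ l
      (v , Wv) = W-nonempty Z≠∅ r
      (s , us) = RSumT-nonempty u z
      (t , st) = LSumT-nonempty s v
  in t , s , v , (u , z , Wu , Zz , us) , Wv , st

isLeaf : Tree → Bool
isLeaf leaf       = true
isLeaf (node _ _) = false

deg≡⇒isLeaf≡ : ∀ {x y} → deg x ≡ deg y → isLeaf x ≡ isLeaf y
deg≡⇒isLeaf≡ {leaf}     {leaf}     _  = refl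
deg≡⇒isLeaf≡ {node _ _} {node _ _} _  = refl
deg≡⇒isLeaf≡ {leaf}     {node _ _} ()
deg≡⇒isLeaf≡ {node _ _} {leaf}     ()

LSumT-isLeaf : ∀ {x y z} → LSumT x y z → isLeaf z ≡ isLeaf x
LSumT-isLeaf {leaf}     refl           = refl
LSumT-isLeaf {node _ _} (_ , _ , refl) = refl

RSumT-isLeaf : ∀ {x y z} → RSumT x y z → isLeaf z ≡ isLeaf y
RSumT-isLeaf {y = leaf}     refl           = refl
RSumT-isLeaf {y = node _ _} (_ , _ , refl) = refl

W-node-isLeaf : ∀ {Z l r t} → W (node l r) Z t → ∃[ z ] Z z × isLeaf t ≡ isLeaf z
W-node-isLeaf (x , y , (x₁ , z , _ , Zz , x₁z) , _ , xy) =
  z , Zz , trans (LSumT-isLeaf {x} {y} xy) (RSumT-isLeaf {x₁} {z} x₁z)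

-- Without the shape hypothesis this fails: | ⊣ y = {|} is not contained in | + y = {y} for y ≠ |.
SumT⇒LSumT⊎RSumT : ∀ {x y t} → isLeaf x ≡ isLeaf y → SumT x y t → LSumT x y t ⊎ RSumT x y t
SumT⇒LSumT⊎RSumT {leaf}     {leaf}     _ s = inj₁ (SumT-leafˡ-unique s)
SumT⇒LSumT⊎RSumT {node _ _} {node _ _} _ s = SumT⊆LSumT⊎RSumT s
SumT⇒LSumT⊎RSumT {leaf}     {node _ _} () _
SumT⇒LSumT⊎RSumT {node _ _} {leaf}     () _

LSumT⊎RSumT⇒SumT : ∀ {x y t} → isLeaf x ≡ isLeaf y → LSumT x y t ⊎ RSumT x y t → SumT x y t
LSumT⊎RSumT⇒SumT {leaf}     {leaf}     _ (inj₁ refl) = SumT-leafˡ leaf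
LSumT⊎RSumT⇒SumT {leaf}     {leaf}     _ (inj₂ refl) = SumT-leafˡ leaf
LSumT⊎RSumT⇒SumT {node a b} {node _ _} _ (inj₁ l)    = LSumT⊆SumT {a} {b} l
LSumT⊎RSumT⇒SumT {node a b} {node c d} _ (inj₂ r)    = RSumT⊆SumT {node a b} {c} {d} r
LSumT⊎RSumT⇒SumT {leaf}     {node _ _} () _
LSumT⊎RSumT⇒SumT {node _ _} {leaf}     () _

Bind-assoc : ∀ X (f g : Tree → Grove) → Bind (Bind X f) g ≐ Bind X (λ x → Bind (f x) g)
Bind-assoc X f g t = (λ (s , (x , Xx , fs) , gt) → x , Xx , s , fs , gt)
                   , (λ (x , Xx , s , fs , gt) → s , (x , Xx , fs) , gt)

Bind-cong : ∀ X {f g : Tree → Grove} → (∀ x → f x ≐ g x) → Bind X f ≐ Bind X g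
Bind-cong X e t = (λ (x , Xx , fx) → x , Xx , proj₁ (e x t) fx)
                , (λ (x , Xx , gx) → x , Xx , proj₂ (e x t) gx)

-- All trees of a grove Z have one degree, so the trees of W_{a∨b}(Z) are all leaves or all nodes.
module _ (Z : Grove) (Z-grove : IsGrove Z) where

  private
    Wᶻ : Tree → Grove
    Wᶻ x = W x Z

    Z≠∅ : ∃ Z
    Z≠∅ = proj₁ Z-grove

    W-node-isLeaf≡ : ∀ {a b c d x y} → Wᶻ (node a b) x → Wᶻ (node c d) y → isLeaf x ≡ isLeaf y
    W-node-isLeaf≡ {a} {b} {c} {d} Wx Wy =
      let (z , Zz , x≡z) = W-node-isLeaf {Z} {a} {b} Wx
          (z′ , Zz′ , y≡z′) = W-node-isLeaf {Z} {c} {d} Wy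
      in trans x≡z (trans (deg≡⇒isLeaf≡ (proj₂ Z-grove z z′ Zz Zz′)) (sym y≡z′))

  W-Sum-node : ∀ {a₁ a₂ c₁ c₂} → let a = node a₁ a₂; c = node c₁ c₂ in
               Bind (LSumT a c) Wᶻ ≐ Lift LSumT (Wᶻ a) (Wᶻ c) →
               Bind (RSumT a c) Wᶻ ≐ Lift RSumT (Wᶻ a) (Wᶻ c) →
               Bind (SumT a c) Wᶻ ≐ Lift SumT (Wᶻ a) (Wᶻ c)
  W-Sum-node {a₁} {a₂} {c₁} {c₂} W-LSum-ac W-RSum-ac t = to , from
    where
    a = node a₁ a₂
    c = node c₁ c₂
    same-shape : ∀ {x y} → Wᶻ a x → Wᶻ c y → isLeaf x ≡ isLeaf y
    same-shape = W-node-isLeaf≡ {a₁} {a₂} {c₁} {c₂}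
    to : Bind (SumT a c) Wᶻ t → Lift SumT (Wᶻ a) (Wᶻ c) t
    to (s , acs , Ws) with SumT⊆LSumT⊎RSumT {a₁} {a₂} {c₁} {c₂} {s} acs
    ... | inj₁ l = let (x , y , Wx , Wy , xyt) = proj₁ (W-LSum-ac t) (s , l , Ws) in
                   x , y , Wx , Wy , LSumT⊎RSumT⇒SumT (same-shape Wx Wy) (inj₁ xyt)
    ... | inj₂ r = let (x , y , Wx , Wy , xyt) = proj₁ (W-RSum-ac t) (s , r , Ws) in
                   x , y , Wx , Wy , LSumT⊎RSumT⇒SumT (same-shape Wx Wy) (inj₂ xyt)
    from : Lift SumT (Wᶻ a) (Wᶻ c) t → Bind (SumT a c) Wᶻ t
    from (x , y , Wx , Wy , xyt) with SumT⇒LSumT⊎RSumT (same-shape Wx Wy) xyt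
    ... | inj₁ l = let (s , acs , Ws) = proj₂ (W-LSum-ac t) (x , y , Wx , Wy , l) in
                   s , LSumT⊆SumT {a₁} {a₂} acs , Ws
    ... | inj₂ r = let (s , acs , Ws) = proj₂ (W-RSum-ac t) (x , y , Wx , Wy , r) in
                   s , RSumT⊆SumT {a} {c₁} {c₂} acs , Ws

  W-LSum : ∀ a c → Bind (LSumT a c) Wᶻ ≐ Lift LSumT (Wᶻ a) (Wᶻ c)
  W-RSum : ∀ a c → Bind (RSumT a c) Wᶻ ≐ Lift RSumT (Wᶻ a) (Wᶻ c)
  W-Sum  : ∀ a c → Bind (SumT a c) Wᶻ ≐ Lift SumT (Wᶻ a) (Wᶻ c)

  W-LSum leaf c t =
    (λ { (_ , refl , refl) → let (y , Wy) = W-nonempty Z≠∅ c in leaf , y , refl , Wy , refl }) ,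
    (λ { (_ , _ , refl , _ , refl) → leaf , refl , refl })
  W-LSum (node a₁ a₂) c = begin
    Bind (LSumT (node a₁ a₂) c) Wᶻ                ≈⟨ Bind-image (SumT a₂ c) (node a₁) Wᶻ ⟩
    Bind (SumT a₂ c) (λ w → Lift LSumT A₁ (Wᶻ w)) ≈⟨ Bind-Liftʳ LSumT A₁ (SumT a₂ c) Wᶻ ⟩
    Lift LSumT A₁ (Bind (SumT a₂ c) Wᶻ)           ≈⟨ Lift-cong LSumT ≐-refl (W-Sum a₂ c) ⟩
    Lift LSumT A₁ (Lift SumT (Wᶻ a₂) (Wᶻ c))      ≈⟨ LSum-LSum A₁ (Wᶻ a₂) (Wᶻ c) ⟨
    Lift LSumT (Lift LSumT A₁ (Wᶻ a₂)) (Wᶻ c)     ∎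
    where
    open Relation.Binary.Reasoning.Setoid ≐-setoid
    A₁ = Lift RSumT (Wᶻ a₁) Z

  W-RSum a leaf t =
    (λ { (_ , refl , refl) → let (x , Wx) = W-nonempty Z≠∅ a in x , leaf , Wx , refl , refl }) ,
    (λ { (_ , _ , _ , refl , refl) → leaf , refl , refl })
  W-RSum a (node c₁ c₂) = begin
    Bind (RSumT a (node c₁ c₂)) Wᶻ
      ≈⟨ Bind-image (SumT a c₁) (λ w → node w c₂) Wᶻ ⟩
    Bind (SumT a c₁) (λ w → Lift LSumT (Lift RSumT (Wᶻ w) Z) (Wᶻ c₂))
      ≈⟨ Bind-Liftˡ LSumT (Wᶻ c₂) (SumT a c₁) _ ⟩
    Lift LSumT (Bind (SumT a c₁) (λ w → Lift RSumT (Wᶻ w) Z)) (Wᶻ c₂)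
      ≈⟨ Lift-cong LSumT (Bind-Liftˡ RSumT Z (SumT a c₁) Wᶻ) ≐-refl ⟩
    Lift LSumT (Lift RSumT (Bind (SumT a c₁) Wᶻ) Z) (Wᶻ c₂)
      ≈⟨ Lift-cong LSumT (Lift-cong RSumT (W-Sum a c₁) ≐-refl) ≐-refl ⟩
    Lift LSumT (Lift RSumT (Lift SumT (Wᶻ a) (Wᶻ c₁)) Z) (Wᶻ c₂)
      ≈⟨ Lift-cong LSumT (Sum-RSum (Wᶻ a) (Wᶻ c₁) Z) ≐-refl ⟩
    Lift LSumT (Lift RSumT (Wᶻ a) C₁) (Wᶻ c₂)
      ≈⟨ RSum-LSum (Wᶻ a) C₁ (Wᶻ c₂) ⟩
    Lift RSumT (Wᶻ a) (Lift LSumT C₁ (Wᶻ c₂))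
      ∎
    where
    open Relation.Binary.Reasoning.Setoid ≐-setoid
    C₁ = Lift RSumT (Wᶻ c₁) Z

  W-Sum leaf c t =
    (λ (s , cs , Ws) → leaf , t , refl , subst (λ u → Wᶻ u t) (SumT-leafˡ-unique cs) Ws , SumT-leafˡ t) ,
    (λ { (_ , y , refl , Wy , yt) → c , SumT-leafˡ c , subst (Wᶻ c) (sym (SumT-leafˡ-unique yt)) Wy })
  W-Sum a@(node _ _) leaf t =
    (λ (s , as , Ws) → t , leaf , subst (λ u → Wᶻ u t) (SumT-leafʳ-unique as) Ws , refl , SumT-leafʳ t) ,
    (λ { (x , _ , Wx , refl , xt) → a , SumT-leafʳ a , subst (Wᶻ a) (sym (SumT-leafʳ-unique xt)) Wx })
  W-Sum a@(node _ _) c@(node _ _) = W-Sum-node (W-LSum a c) (W-RSum a c)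

  W-×G : ∀ Y x → Bind (W x Y) Wᶻ ≐ W x (Y ×G Z)
  W-×G Y leaf t = (λ { (_ , refl , refl) → refl }) , (λ { refl → leaf , refl , refl })
  W-×G Y (node l r) = begin
    Bind (Lift LSumT (Lift RSumT (W l Y) Y) (W r Y)) Wᶻ
      ≈⟨ Bind-Lift LSumT LSumT Wᶻ W-LSum _ (W r Y) ⟩
    Lift LSumT (Bind (Lift RSumT (W l Y) Y) Wᶻ) (Bind (W r Y) Wᶻ)
      ≈⟨ Lift-cong LSumT (Bind-Lift RSumT RSumT Wᶻ W-RSum (W l Y) Y) (W-×G Y r) ⟩
    Lift LSumT (Lift RSumT (Bind (W l Y) Wᶻ) (Y ×G Z)) (W r (Y ×G Z))
      ≈⟨ Lift-cong LSumT (Lift-cong RSumT (W-×G Y l) ≐-refl) ≐-refl ⟩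
    W (node l r) (Y ×G Z)
      ∎
    where open Relation.Binary.Reasoning.Setoid ≐-setoid

  ×G-assoc : ∀ X Y → ((X ×G Y) ×G Z) ≐ (X ×G (Y ×G Z))
  ×G-assoc X Y = begin
    Bind (Bind X (λ x → W x Y)) Wᶻ    ≈⟨ Bind-assoc X (λ x → W x Y) Wᶻ ⟩
    Bind X (λ x → Bind (W x Y) Wᶻ)    ≈⟨ Bind-cong X (W-×G Y) ⟩
    Bind X (λ x → W x (Y ×G Z))       ∎
    where open Relation.Binary.Reasoning.Setoid ≐-setoid

RSumT-leafˡ : ∀ y → RSumT leaf y y
RSumT-leafˡ leaf       = refl
RSumT-leafˡ (node a b) = a , SumT-leafˡ a , refl

RSumT-leafˡ-unique : ∀ {y z} → RSumT leaf y z → z ≡ y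
RSumT-leafˡ-unique {leaf}     refl            = refl
RSumT-leafˡ-unique {node _ _} (_ , aw , refl) = cong (λ u → node u _) (SumT-leafˡ-unique aw)

LSumT-leafʳ : ∀ x → LSumT x leaf x
LSumT-leafʳ leaf       = refl
LSumT-leafʳ (node a b) = b , SumT-leafʳ b , refl

LSumT-leafʳ-unique : ∀ {x z} → LSumT x leaf z → z ≡ x
LSumT-leafʳ-unique {leaf}     refl            = refl
LSumT-leafʳ-unique {node _ _} (_ , bw , refl) = cong (node _) (SumT-leafʳ-unique bw)

×G-identityˡ : ∀ Y → (⟦ one ⟧ ×G Y) ≐ Y
×G-identityˡ Y t =
  (λ { (_ , refl , x , _ , (_ , y , refl , Yy , yx) , refl , xt) →
         subst Y (sym (trans (LSumT-leafʳ-unique {x} xt) (RSumT-leafˡ-unique {y} yx))) Yy }) ,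
  (λ Yt → one , refl , t , leaf , (leaf , t , refl , Yt , RSumT-leafˡ t) , refl , LSumT-leafʳ t)

W-one-unique : ∀ x {t} → W x ⟦ one ⟧ t → t ≡ x
W-one-unique leaf       refl = refl
W-one-unique (node l r) (_ , _ , (_ , _ , Wl , refl , (_ , lw , refl)) , Wr , (_ , rw′ , refl)) =
  cong₂ node (trans (SumT-leafʳ-unique lw) (W-one-unique l Wl))
             (trans (SumT-leafˡ-unique rw′) (W-one-unique r Wr))

W-one : ∀ x → W x ⟦ one ⟧ x
W-one leaf       = refl
W-one (node l r) =
  node l leaf , r , (l , one , W-one l , refl , l , SumT-leafʳ l , refl) , W-one r , r , SumT-leafˡ r , refl

×G-identityʳ : ∀ X → (X ×G ⟦ one ⟧) ≐ X
×G-identityʳ X t = (λ (x , Xx , Wt) → subst X (sym (W-one-unique x Wt)) Xx) , (λ Xt → t , Xt , W-one t)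

proposition6p3 : (∀ (X Y Z : Grove) → IsGrove X → IsGrove Y → IsGrove Z → ((X ×G Y) ×G Z) ≐ (X ×G (Y ×G Z)))
    × (∀ (Y : Grove) → IsGrove Y → (⟦ one ⟧ ×G Y) ≐ Y)
    × (∀ (X : Grove) → IsGrove X → (X ×G ⟦ one ⟧) ≐ X)
proposition6p3 = (λ X Y Z _ _ Z-grove → ×G-assoc Z Z-grove X Y)
               , (λ Y _ → ×G-identityˡ Y)
               , (λ X _ → ×G-identityʳ X)
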